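{- For every finite string $w$ over $\{0,1\}$: $\psi(w)=0$ if and only if $\xi(w)=0$.
   Context: $\#w$ is the length, $\varepsilon$ the empty string; for $\#w\ge1$, $l(w)$ is $w$ without its last letter and $r(w)$ is $w$ without its first letter. $T^n$ is the alternating string of length $n$ starting with $0$ ($T^0=\varepsilon$, $T^n=T^{n-1}0$ for odd $n$, $T^n=T^{n-1}1$ for even $n\ge2$) and $CT^n$ its letterwise complement. $\xi$: $\xi(\varepsilon)=0$; $\xi(w)=1$ if $w=T^k$, $k\ge2$ even; $\xi(w)=-1$ if $w=CT^k$, $k\ge2$ even; otherwise $\xi(w)=\operatorname{sgn}(\xi(l(w))+\xi(r(w)))$. $\phi$: $\phi(\varepsilon)=0$; $\phi(w)=-1$ if $w=0^k$, $k$ odd; $\phi(w)=1$ if $w=1^k$, $k$ odd; otherwise $\phi(w)=\operatorname{sgn}(\phi(r(w))-\phi(l(w)))$. $\psi(w)=\xi(w)^{\#w}\phi(w)$ (with $0^0=1$). -}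

module Defs where

open import Data.Bool using (Bool; true; false; _∧_; if_then_else_; not)
open import Data.Nat using (ℕ; zero; suc)
open import Data.List using (List; []; _∷_; _++_; [_]; length; map)
open import Data.Integer using (ℤ; +_; -[1+_]; _+_; _-_; _*_; _^_; -_)

-- Letters: false = 0, true = 1.  Strings are List Bool.

sgn : ℤ → ℤ
sgn (+ zero)    = + 0
sgn (+ suc _)   = + 1
sgn -[1+ _ ]    = - (+ 1)

l : List Bool → List Bool
l []           = []
l (x ∷ [])     = []
l (x ∷ y ∷ ys) = x ∷ l (y ∷ ys)

r : List Bool → List Bool
r []       = []
r (_ ∷ xs) = xs

isEven : ℕ → Bool
isEven zero    = true
isEven (suc n) = not (isEven n)

T : ℕ → List Bool
T zero    = []
T (suc n) = T n ++ [ (if isEven (suc n) then true else false) ]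

CT : ℕ → List Bool
CT n = map not (T n)

rep : ℕ → Bool → List Bool
rep zero    b = []
rep (suc n) b = b ∷ rep n b

eqB : Bool → Bool → Bool
eqB true  true  = true
eqB false false = true
eqB _     _     = false

eqL : List Bool → List Bool → Bool
eqL []       []       = true
eqL (x ∷ xs) (y ∷ ys) = eqB x y ∧ eqL xs ys
eqL _        _        = false

-- "w = T^k for some even k ≥ 2" (necessarily k = #w)
isTeven : List Bool → Bool
isTeven w with length w
... | zero  = false
... | suc zero = false
... | suc (suc m) = isEven m ∧ eqL w (T (suc (suc m)))

isCTeven : List Bool → Bool
isCTeven w with length w
... | zero  = false
... | suc zero = false
... | suc (suc m) = isEven m ∧ eqL w (CT (suc (suc m)))

-- "w = b^k for some odd k" (necessarily k = #w)
isRepOdd : Bool → List Bool → Bool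
isRepOdd b w = not (isEven (length w)) ∧ eqL w (rep (length w) b)

-- ξ and φ, computed with fuel n; the fuel is always #w (the recursive
-- calls are on l(w), r(w) of length #w - 1), so fuel never runs out early.
ξ-aux : ℕ → List Bool → ℤ
ξ-aux _ [] = + 0
ξ-aux zero (_ ∷ _) = + 0   -- unreachable when fuel = #w
ξ-aux (suc n) w@(_ ∷ _) =
  if isTeven w then + 1
  else if isCTeven w then - (+ 1)
  else sgn (ξ-aux n (l w) + ξ-aux n (r w))

ξ : List Bool → ℤ
ξ w = ξ-aux (length w) w

φ-aux : ℕ → List Bool → ℤ
φ-aux _ [] = + 0
φ-aux zero (_ ∷ _) = + 0   -- unreachable when fuel = #w
φ-aux (suc n) w@(_ ∷ _) =
  if isRepOdd false w then - (+ 1)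
  else if isRepOdd true w then + 1
  else sgn (φ-aux n (r w) - φ-aux n (l w))

φ : List Bool → ℤ
φ w = φ-aux (length w) w

-- ψ(w) = ξ(w)^{#w} φ(w)   (ℤ's _^_ has x ^ 0 = 1)
ψ : List Bool → ℤ
ψ w = (ξ w ^ length w) * φ w

-- Since ψ w = ξ w ^ #w · φ w, it suffices to show that φ w = 0 forces ξ w = 0.  On words
-- of odd length φ never vanishes, and on words of even length φ w = 0 iff φ (l w) = φ (r w);
-- the heart of the proof is that, for even #w, also ξ w = 0 iff φ (l w) = φ (r w).
--
-- Everything is proved by induction on the length, two letters at a time.  Unfolding each
-- recursion twice expresses ξ (resp. φ) of a word through its values on the three subwords
-- of length two less by a fixed sign rule ξ-step (resp. φ-step), provided the exceptional
-- alternating (resp. constant) words are exactly those on which these three values zigzag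
-- (resp. are flat), which is proved alongside.  The values alone do not propagate the link
-- between the zeros of ξ and the equalities of φ: each word also carries a token, the
-- orientation of the nearest nonzero ξ down its central column, and neighbouring subwords
-- have coherent tokens, which is part of the induction too.  Each inductive step then comes
-- down to a finite fact about signs, checked by evaluation.

module Submission where

open import Defs
open import Data.Bool using (Bool; true; false; not; _∧_; if_then_else_)
open import Data.Bool.Properties using (not-involutive) renaming (_≟_ to _≟ᵇ_)
open import Data.Nat using (ℕ; zero; suc; _+_)
open import Data.Nat.Properties using (+-suc; suc-injective)
open import Data.List using (List; []; _∷_; _++_; [_]; length; map; iterate)
open import Data.List.Properties using (∷-injectiveˡ; length-iterate) renaming (≡-dec to ≡-decᴸ)
open import Data.Integer using (ℤ; +_; _^_; _*_)
import Data.Integer as ℤ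
open import Data.Integer.Properties using (i*j≡0⇒i≡0∨j≡0; i^n≡0⇒i≡0)
open import Data.Product using (_×_; _,_; Σ; proj₁; proj₂)
open import Data.Sum using (_⊎_; inj₁; inj₂)
open import Data.Unit using (⊤)
open import Function using (_∘_; id)
open import Function.Bundles using (_⇔_; mk⇔; Equivalence)
open import Relation.Binary.Definitions using (DecidableEquality)
open import Relation.Binary.PropositionalEquality
  using (_≡_; _≢_; refl; sym; trans; cong; cong₂; subst; subst₂; module ≡-Reasoning)
open import Relation.Nullary using (Dec; yes; no; ¬_; contradiction)
open import Relation.Nullary.Decidable using (map′; from-yes; _×-dec_; _→-dec_; ¬?)

-- Signs

infix  4 _≟_
infix  3 _⇔?_
infixl 6 _⊕_ _⊖_
infix  8 -ₛ_

data Sgn : Set where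
  ⁻ ⁰ ⁺ : Sgn

_≟_ : DecidableEquality Sgn
⁻ ≟ ⁻ = yes refl
⁻ ≟ ⁰ = no λ ()
⁻ ≟ ⁺ = no λ ()
⁰ ≟ ⁻ = no λ ()
⁰ ≟ ⁰ = yes refl
⁰ ≟ ⁺ = no λ ()
⁺ ≟ ⁻ = no λ ()
⁺ ≟ ⁰ = no λ ()
⁺ ≟ ⁺ = yes refl

-ₛ_ : Sgn → Sgn
-ₛ ⁻ = ⁺
-ₛ ⁰ = ⁰
-ₛ ⁺ = ⁻

_⊕_ : Sgn → Sgn → Sgn
⁰ ⊕ b = b
a ⊕ ⁰ = a
⁺ ⊕ ⁺ = ⁺
⁻ ⊕ ⁻ = ⁻
_ ⊕ _ = ⁰

_⊖_ : Sgn → Sgn → Sgn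
a ⊖ b = a ⊕ -ₛ b

bitSign : Bool → Sgn
bitSign false = ⁻
bitSign true  = ⁺

⟦_⟧ : Sgn → ℤ
⟦ ⁻ ⟧ = ℤ.- + 1
⟦ ⁰ ⟧ = + 0
⟦ ⁺ ⟧ = + 1

∀ᵇ? : {P : Bool → Set} → ((b : Bool) → Dec (P b)) → Dec ((b : Bool) → P b)
∀ᵇ? P? = map′ (λ { (p , q) false → p ; (p , q) true → q }) (λ f → f false , f true)
              (P? false ×-dec P? true)

∀ˢ? : {P : Sgn → Set} → ((s : Sgn) → Dec (P s)) → Dec ((s : Sgn) → P s)
∀ˢ? P? = map′ (λ { (p , q , r) ⁻ → p ; (p , q , r) ⁰ → q ; (p , q , r) ⁺ → r })
              (λ f → f ⁻ , f ⁰ , f ⁺) (P? ⁻ ×-dec P? ⁰ ×-dec P? ⁺)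

_⇔?_ : {A B : Set} → Dec A → Dec B → Dec (A ⇔ B)
a? ⇔? b? = map′ (λ (f , g) → mk⇔ f g) (λ e → Equivalence.to e , Equivalence.from e)
                ((a? →-dec b?) ×-dec (b? →-dec a?))

⟦⊕⟧ : ∀ a b → sgn (⟦ a ⟧ ℤ.+ ⟦ b ⟧) ≡ ⟦ a ⊕ b ⟧
⟦⊕⟧ = from-yes (∀ˢ? λ a → ∀ˢ? λ b → sgn (⟦ a ⟧ ℤ.+ ⟦ b ⟧) ℤ.≟ ⟦ a ⊕ b ⟧)

⟦⊖⟧ : ∀ a b → sgn (⟦ a ⟧ ℤ.- ⟦ b ⟧) ≡ ⟦ a ⊖ b ⟧
⟦⊖⟧ = from-yes (∀ˢ? λ a → ∀ˢ? λ b → sgn (⟦ a ⟧ ℤ.- ⟦ b ⟧) ℤ.≟ ⟦ a ⊖ b ⟧)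

⟦⟧≡0⇒≡⁰ : ∀ a → ⟦ a ⟧ ≡ + 0 → a ≡ ⁰
⟦⟧≡0⇒≡⁰ ⁰ _ = refl

⊖≡⁰⇒≡ : ∀ a b → a ⊖ b ≡ ⁰ → a ≡ b
⊖≡⁰⇒≡ = from-yes (∀ˢ? λ a → ∀ˢ? λ b → (a ⊖ b ≟ ⁰) →-dec (a ≟ b))

Ξ-fuel : ℕ → List Bool → Sgn
Ξ-fuel _ [] = ⁰
Ξ-fuel zero (_ ∷ _) = ⁰
Ξ-fuel (suc n) w@(_ ∷ _) =
  if isTeven w then ⁺ else if isCTeven w then ⁻ else Ξ-fuel n (l w) ⊕ Ξ-fuel n (r w)

Φ-fuel : ℕ → List Bool → Sgn
Φ-fuel _ [] = ⁰
Φ-fuel zero (_ ∷ _) = ⁰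
Φ-fuel (suc n) w@(_ ∷ _) =
  if isRepOdd false w then ⁻ else if isRepOdd true w then ⁺ else Φ-fuel n (r w) ⊖ Φ-fuel n (l w)

⟦Ξ-fuel⟧ : ∀ n w → ⟦ Ξ-fuel n w ⟧ ≡ ξ-aux n w
⟦Ξ-fuel⟧ _ [] = refl
⟦Ξ-fuel⟧ zero (_ ∷ _) = refl
⟦Ξ-fuel⟧ (suc n) w@(_ ∷ _) with isTeven w | isCTeven w
... | true  | _     = refl
... | false | true  = refl
... | false | false = trans (sym (⟦⊕⟧ (Ξ-fuel n (l w)) (Ξ-fuel n (r w))))
                           (cong₂ (λ a b → sgn (a ℤ.+ b)) (⟦Ξ-fuel⟧ n (l w)) (⟦Ξ-fuel⟧ n (r w)))

⟦Φ-fuel⟧ : ∀ n w → ⟦ Φ-fuel n w ⟧ ≡ φ-aux n w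
⟦Φ-fuel⟧ _ [] = refl
⟦Φ-fuel⟧ zero (_ ∷ _) = refl
⟦Φ-fuel⟧ (suc n) w@(_ ∷ _) with isRepOdd false w | isRepOdd true w
... | true  | _     = refl
... | false | true  = refl
... | false | false = trans (sym (⟦⊖⟧ (Φ-fuel n (r w)) (Φ-fuel n (l w))))
                           (cong₂ (λ a b → sgn (a ℤ.- b)) (⟦Φ-fuel⟧ n (r w)) (⟦Φ-fuel⟧ n (l w)))

Ξ Φ : List Bool → Sgn
Ξ w = Ξ-fuel (length w) w
Φ w = Φ-fuel (length w) w

-- Words and windows

length-l-∷ : ∀ a w → length (l (a ∷ w)) ≡ length w
length-l-∷ a [] = refl
length-l-∷ a (b ∷ w) = cong suc (length-l-∷ b w)

r-l : ∀ w → r (l w) ≡ l (r w)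
r-l [] = refl
r-l (_ ∷ []) = refl
r-l (_ ∷ _ ∷ _) = refl

l-iterate : ∀ (f : Bool → Bool) b n → l (iterate f b (suc n)) ≡ iterate f b n
l-iterate f b zero = refl
l-iterate f b (suc n) = cong (b ∷_) (l-iterate f (f b) n)

iterate-from-l-r : ∀ (f : Bool → Bool) b n y →
  l y ≡ iterate f b (suc n) → r y ≡ iterate f (f b) (suc n) → y ≡ iterate f b (2 + n)
iterate-from-l-r f b n (a ∷ c ∷ y) ly ry = cong₂ _∷_ (∷-injectiveˡ ly) ry

dropFront : ℕ → List Bool → List Bool
dropFront zero x = x
dropFront (suc i) x = r (dropFront i x)

window : ℕ → ℕ → List Bool → List Bool
window i zero x = dropFront i x
window i (suc j) x = l (window i j x)

r-window : ∀ i j x → r (window i j x) ≡ window (suc i) j x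
r-window i zero x = refl
r-window i (suc j) x = trans (r-l (window i j x)) (cong l (r-window i j x))

lr-window : ∀ i j x → l (r (window i j x)) ≡ window (suc i) (suc j) x
lr-window i j x = cong l (r-window i j x)

rr-window : ∀ i j x → r (r (window i j x)) ≡ window (2 + i) j x
rr-window i j x = trans (cong r (r-window i j x)) (r-window (suc i) j x)

length-l : ∀ {n} w → length w ≡ suc n → length (l w) ≡ n
length-l (a ∷ w) eq = trans (length-l-∷ a w) (suc-injective eq)

length-r : ∀ {n} w → length w ≡ suc n → length (r w) ≡ n
length-r (a ∷ w) eq = suc-injective eq

length-dropFront : ∀ i x n → length x ≡ i + n → length (dropFront i x) ≡ n
length-dropFront zero x n eq = eq
length-dropFront (suc i) x n eq =
  length-r (dropFront i x) (length-dropFront i x (suc n) (trans eq (sym (+-suc i n))))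

length-window : ∀ i j x n → length x ≡ i + (j + n) → length (window i j x) ≡ n
length-window i zero x n eq = length-dropFront i x n eq
length-window i (suc j) x n eq =
  length-l (window i j x) (length-window i j x (suc n) (trans eq (cong (λ m → i + m) (sym (+-suc j n)))))

window-iterate : ∀ (f : Bool → Bool) b n i j x →
  window i (suc j) x ≡ iterate f b (suc n) → window (suc i) j x ≡ iterate f (f b) (suc n) →
  window i j x ≡ iterate f b (2 + n)
window-iterate f b n i j x wl wr = iterate-from-l-r f b n (window i j x) wl (trans (r-window i j x) wr)

double : ℕ → ℕ
double zero = zero
double (suc k) = suc (suc (double k))

isEven-double : ∀ k → isEven (double k) ≡ true
isEven-double zero = refl
isEven-double (suc k) = trans (not-involutive (isEven (double k))) (isEven-double k)

eqB-sound : ∀ a b → eqB a b ≡ true → a ≡ b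
eqB-sound true true _ = refl
eqB-sound false false _ = refl

eqL-sound : ∀ u v → eqL u v ≡ true → u ≡ v
eqL-sound [] [] _ = refl
eqL-sound (a ∷ u) (b ∷ v) eq with eqB a b in ab
... | true = cong₂ _∷_ (eqB-sound a b ab) (eqL-sound u v eq)

eqL-refl : ∀ u → eqL u u ≡ true
eqL-refl [] = refl
eqL-refl (false ∷ u) = eqL-refl u
eqL-refl (true ∷ u) = eqL-refl u

iterate-not-snoc : ∀ b n → iterate not b (suc n) ≡ iterate not b n ++ [ (if isEven n then b else not b) ]
iterate-not-snoc b zero = refl
iterate-not-snoc b (suc n) =
  cong (b ∷_) (trans (iterate-not-snoc (not b) n) (cong (λ c → iterate not (not b) n ++ [ c ]) (last-letter n)))
  where
  last-letter : ∀ n → (if isEven n then not b else not (not b)) ≡ (if isEven (suc n) then b else not b)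
  last-letter n with isEven n
  ... | true = refl
  ... | false = not-involutive b

T≡iterate : ∀ n → T n ≡ iterate not false n
T≡iterate zero = refl
T≡iterate (suc n) = trans (cong₂ (λ u c → u ++ [ c ]) (T≡iterate n) (last-letter n)) (sym (iterate-not-snoc false n))
  where
  last-letter : ∀ n → (if isEven (suc n) then true else false) ≡ (if isEven n then false else true)
  last-letter n with isEven n
  ... | true = refl
  ... | false = refl

CT≡iterate : ∀ n → CT n ≡ iterate not true n
CT≡iterate n = trans (cong (map not) (T≡iterate n)) (map-not false n)
  where
  map-not : ∀ b n → map not (iterate not b n) ≡ iterate not (not b) n
  map-not b zero = refl
  map-not b (suc n) = cong (not b ∷_) (map-not (not b) n)

rep≡iterate : ∀ n b → rep n b ≡ iterate id b n
rep≡iterate zero b = refl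
rep≡iterate (suc n) b = cong (b ∷_) (rep≡iterate n b)

isEven-suc-suc : ∀ n → isEven (suc (suc n)) ≡ isEven n
isEven-suc-suc n = not-involutive (isEven n)

isTeven-even : ∀ k y → length y ≡ 2 + double k → isTeven y ≡ eqL y (iterate not false (2 + double k))
isTeven-even k y@(a ∷ b ∷ t) eq rewrite suc-injective (suc-injective eq) =
  cong₂ _∧_ (isEven-double k) (cong (eqL y) (T≡iterate (2 + double k)))

isCTeven-even : ∀ k y → length y ≡ 2 + double k → isCTeven y ≡ eqL y (iterate not true (2 + double k))
isCTeven-even k y@(a ∷ b ∷ t) eq rewrite suc-injective (suc-injective eq) =
  cong₂ _∧_ (isEven-double k) (cong (eqL y) (CT≡iterate (2 + double k)))

isTeven-odd : ∀ y → isEven (length y) ≡ false → isTeven y ≡ false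
isTeven-odd (a ∷ []) _ = refl
isTeven-odd (a ∷ b ∷ t) odd rewrite trans (sym (isEven-suc-suc (length t))) odd = refl

isCTeven-odd : ∀ y → isEven (length y) ≡ false → isCTeven y ≡ false
isCTeven-odd (a ∷ []) _ = refl
isCTeven-odd (a ∷ b ∷ t) odd rewrite trans (sym (isEven-suc-suc (length t))) odd = refl

isEven-odd-length : ∀ k (y : List Bool) → length y ≡ 1 + double k → isEven (length y) ≡ false
isEven-odd-length k y eq = trans (cong isEven eq) (cong not (isEven-double k))

isEven-even-length : ∀ k (y : List Bool) → length y ≡ 2 + double k → isEven (length y) ≡ true
isEven-even-length k y eq = trans (cong isEven eq) (isEven-double (suc k))

isRepOdd-odd : ∀ k b y → length y ≡ 1 + double k → isRepOdd b y ≡ eqL y (iterate id b (1 + double k))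
isRepOdd-odd k b y eq rewrite eq =
  cong₂ _∧_ (cong (not ∘ not) (isEven-double k)) (cong (eqL y) (rep≡iterate (1 + double k) b))

isRepOdd-even : ∀ k b y → length y ≡ 2 + double k → isRepOdd b y ≡ false
isRepOdd-even k b y eq = cong (λ e → not e ∧ eqL y (rep (length y) b)) (isEven-even-length k y eq)

Ξ-unfold : ∀ a w → Ξ (a ∷ w) ≡
  (if isTeven (a ∷ w) then ⁺ else if isCTeven (a ∷ w) then ⁻ else Ξ (l (a ∷ w)) ⊕ Ξ w)
Ξ-unfold a w rewrite length-l-∷ a w = refl

Φ-unfold : ∀ a w → Φ (a ∷ w) ≡
  (if isRepOdd false (a ∷ w) then ⁻ else if isRepOdd true (a ∷ w) then ⁺ else Φ w ⊖ Φ (l (a ∷ w)))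
Φ-unfold a w rewrite length-l-∷ a w = refl

altSign : Bool → Sgn
altSign b = bitSign (not b)

Ξ-odd : ∀ k y → length y ≡ 1 + double k → Ξ y ≡ Ξ (l y) ⊕ Ξ (r y)
Ξ-odd k y@(a ∷ w) eq
  rewrite Ξ-unfold a w | isTeven-odd y (isEven-odd-length k y eq)
        | isCTeven-odd y (isEven-odd-length k y eq) = refl

Ξ-even : ∀ k y → length y ≡ 2 + double k →
  (Σ Bool λ b → y ≡ iterate not b (2 + double k) × Ξ y ≡ altSign b)
  ⊎ ((∀ b → y ≢ iterate not b (2 + double k)) × Ξ y ≡ Ξ (l y) ⊕ Ξ (r y))
Ξ-even k y@(a ∷ w) eq rewrite Ξ-unfold a w with isTeven y in T? | isCTeven y in CT?
... | true | _ = inj₁ (false , eqL-sound _ _ (trans (sym (isTeven-even k y eq)) T?) , refl)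
... | false | true = inj₁ (true , eqL-sound _ _ (trans (sym (isCTeven-even k y eq)) CT?) , refl)
... | false | false = inj₂ (not-alternating , refl)
  where
  not-alternating : ∀ b → y ≢ iterate not b (2 + double k)
  not-alternating false refl with () ← trans (sym T?) (trans (isTeven-even k y eq) (eqL-refl y))
  not-alternating true refl with () ← trans (sym CT?) (trans (isCTeven-even k y eq) (eqL-refl y))

Φ-even : ∀ k y → length y ≡ 2 + double k → Φ y ≡ Φ (r y) ⊖ Φ (l y)
Φ-even k y@(a ∷ w) eq rewrite Φ-unfold a w | isRepOdd-even k false y eq | isRepOdd-even k true y eq = refl

Φ-odd : ∀ k y → length y ≡ 1 + double k →
  (Σ Bool λ b → y ≡ iterate id b (1 + double k) × Φ y ≡ bitSign b)
  ⊎ ((∀ b → y ≢ iterate id b (1 + double k)) × Φ y ≡ Φ (r y) ⊖ Φ (l y))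
Φ-odd k y@(a ∷ w) eq rewrite Φ-unfold a w with isRepOdd false y in F? | isRepOdd true y in T?
... | true | _ = inj₁ (false , eqL-sound _ _ (trans (sym (isRepOdd-odd k false y eq)) F?) , refl)
... | false | true = inj₁ (true , eqL-sound _ _ (trans (sym (isRepOdd-odd k true y eq)) T?) , refl)
... | false | false = inj₂ (not-constant , refl)
  where
  not-constant : ∀ b → y ≢ iterate id b (1 + double k)
  not-constant false refl with () ← trans (sym F?) (trans (isRepOdd-odd k false y eq) (eqL-refl y))
  not-constant true refl with () ← trans (sym T?) (trans (isRepOdd-odd k true y eq) (eqL-refl y))

Ξ-alternating : ∀ k b → Ξ (iterate not b (2 + double k)) ≡ altSign b
Ξ-alternating k b with Ξ-even k (iterate not b (2 + double k)) (length-iterate not b (2 + double k))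
... | inj₁ (b′ , eq , Ξy) = trans Ξy (cong altSign (sym (∷-injectiveˡ eq)))
... | inj₂ (not-alternating , _) = contradiction refl (not-alternating b)

Φ-constant : ∀ k b → Φ (iterate id b (1 + double k)) ≡ bitSign b
Φ-constant k b with Φ-odd k (iterate id b (1 + double k)) (length-iterate id b (1 + double k))
... | inj₁ (b′ , eq , Φy) = trans Φy (cong bitSign (sym (∷-injectiveˡ eq)))
... | inj₂ (not-constant , _) = contradiction refl (not-constant b)

-- Two steps of the recursions

cong₃ : {A B C D : Set} (f : A → B → C → D) {a a′ : A} {b b′ : B} {c c′ : C} →
        a ≡ a′ → b ≡ b′ → c ≡ c′ → f a b c ≡ f a′ b′ c′
cong₃ f refl refl refl = refl

ξ-step : Sgn → Sgn → Sgn → Sgn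
ξ-step ⁺ ⁻ ⁺ = ⁺
ξ-step ⁻ ⁺ ⁻ = ⁻
ξ-step e₀ e₁ e₂ = (e₀ ⊕ e₁) ⊕ (e₁ ⊕ e₂)

φ-step : Sgn → Sgn → Sgn → Sgn
φ-step ⁺ ⁺ ⁺ = ⁺
φ-step ⁻ ⁻ ⁻ = ⁻
φ-step s₀ s₁ s₂ = (s₂ ⊖ s₁) ⊖ (s₁ ⊖ s₀)

Zigzag : Bool → Sgn → Sgn → Sgn → Set
Zigzag b e₀ e₁ e₂ = e₀ ≡ altSign b × e₁ ≡ altSign (not b) × e₂ ≡ altSign b

Flat : Bool → Sgn → Sgn → Sgn → Set
Flat b s₀ s₁ s₂ = s₀ ≡ bitSign b × s₁ ≡ bitSign b × s₂ ≡ bitSign b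

zigzag? : ∀ b e₀ e₁ e₂ → Dec (Zigzag b e₀ e₁ e₂)
zigzag? b e₀ e₁ e₂ = (e₀ ≟ altSign b) ×-dec (e₁ ≟ altSign (not b)) ×-dec (e₂ ≟ altSign b)

flat? : ∀ b s₀ s₁ s₂ → Dec (Flat b s₀ s₁ s₂)
flat? b s₀ s₁ s₂ = (s₀ ≟ bitSign b) ×-dec (s₁ ≟ bitSign b) ×-dec (s₂ ≟ bitSign b)

ξ-step-zigzag : ∀ b → ξ-step (altSign b) (altSign (not b)) (altSign b) ≡ altSign b
ξ-step-zigzag false = refl
ξ-step-zigzag true = refl

φ-step-flat : ∀ b → φ-step (bitSign b) (bitSign b) (bitSign b) ≡ bitSign b
φ-step-flat false = refl
φ-step-flat true = refl

ξ-step-¬zigzag : ∀ e₀ e₁ e₂ → (∀ b → ¬ Zigzag b e₀ e₁ e₂) → ξ-step e₀ e₁ e₂ ≡ (e₀ ⊕ e₁) ⊕ (e₁ ⊕ e₂)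
ξ-step-¬zigzag = from-yes (∀ˢ? λ e₀ → ∀ˢ? λ e₁ → ∀ˢ? λ e₂ →
  (∀ᵇ? λ b → ¬? (zigzag? b e₀ e₁ e₂)) →-dec (ξ-step e₀ e₁ e₂ ≟ (e₀ ⊕ e₁) ⊕ (e₁ ⊕ e₂)))

φ-step-¬flat : ∀ s₀ s₁ s₂ → (∀ b → ¬ Flat b s₀ s₁ s₂) → φ-step s₀ s₁ s₂ ≡ (s₂ ⊖ s₁) ⊖ (s₁ ⊖ s₀)
φ-step-¬flat = from-yes (∀ˢ? λ s₀ → ∀ˢ? λ s₁ → ∀ˢ? λ s₂ →
  (∀ᵇ? λ b → ¬? (flat? b s₀ s₁ s₂)) →-dec (φ-step s₀ s₁ s₂ ≟ (s₂ ⊖ s₁) ⊖ (s₁ ⊖ s₀)))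

PhiFlatForcesConstant : ℕ → Set
PhiFlatForcesConstant k = ∀ x → length x ≡ 3 + double k → ∀ b →
  Flat b (Φ (l (l x))) (Φ (l (r x))) (Φ (r (r x))) → x ≡ iterate id b (3 + double k)

XiZigzagForcesAlternating : ℕ → Set
XiZigzagForcesAlternating k = ∀ y → length y ≡ 4 + double k → ∀ b →
  Zigzag b (Ξ (l (l y))) (Ξ (l (r y))) (Ξ (r (r y))) → y ≡ iterate not b (4 + double k)

Φ-two-step : ∀ {k} → PhiFlatForcesConstant k → ∀ x → length x ≡ 3 + double k →
  Φ x ≡ φ-step (Φ (l (l x))) (Φ (l (r x))) (Φ (r (r x)))
Φ-two-step {k} forces x eq with Φ-odd (suc k) x eq
... | inj₁ (b , refl , Φx) = begin
  Φ x                                                 ≡⟨ Φx ⟩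
  bitSign b                                           ≡⟨ φ-step-flat b ⟨
  φ-step (bitSign b) (bitSign b) (bitSign b)          ≡⟨ cong₃ φ-step window₀ window₁ window₂ ⟨
  φ-step (Φ (l (l x))) (Φ (l (r x))) (Φ (r (r x)))    ∎
  where
  open ≡-Reasoning
  window₀ : Φ (l (l x)) ≡ bitSign b
  window₀ = trans (cong (Φ ∘ l) (l-iterate id b (2 + double k)))
                  (trans (cong Φ (l-iterate id b (1 + double k))) (Φ-constant k b))
  window₁ : Φ (l (r x)) ≡ bitSign b
  window₁ = trans (cong Φ (l-iterate id b (1 + double k))) (Φ-constant k b)
  window₂ : Φ (r (r x)) ≡ bitSign b
  window₂ = Φ-constant k b
... | inj₂ (not-constant , Φx) = begin
  Φ x                                                          ≡⟨ Φx ⟩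
  Φ (r x) ⊖ Φ (l x)                                            ≡⟨ cong₂ _⊖_ Φrx Φlx ⟩
  (Φ (r (r x)) ⊖ Φ (l (r x))) ⊖ (Φ (l (r x)) ⊖ Φ (l (l x)))    ≡⟨ φ-step-¬flat _ _ _ not-flat ⟨
  φ-step (Φ (l (l x))) (Φ (l (r x))) (Φ (r (r x)))             ∎
  where
  open ≡-Reasoning
  Φrx : Φ (r x) ≡ Φ (r (r x)) ⊖ Φ (l (r x))
  Φrx = Φ-even k (r x) (length-r x eq)
  Φlx : Φ (l x) ≡ Φ (l (r x)) ⊖ Φ (l (l x))
  Φlx = trans (Φ-even k (l x) (length-l x eq)) (cong (λ w → Φ w ⊖ Φ (l (l x))) (r-l x))
  not-flat : ∀ b → ¬ Flat b (Φ (l (l x))) (Φ (l (r x))) (Φ (r (r x)))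
  not-flat b flat = not-constant b (forces x eq b flat)

Ξ-two-step : ∀ {k} → XiZigzagForcesAlternating k → ∀ y → length y ≡ 4 + double k →
  Ξ y ≡ ξ-step (Ξ (l (l y))) (Ξ (l (r y))) (Ξ (r (r y)))
Ξ-two-step {k} forces y eq with Ξ-even (suc k) y eq
... | inj₁ (b , refl , Ξy) = begin
  Ξ y                                                           ≡⟨ Ξy ⟩
  altSign b                                                     ≡⟨ ξ-step-zigzag b ⟨
  ξ-step (altSign b) (altSign (not b)) (altSign b)              ≡⟨ cong₃ ξ-step window₀ window₁ window₂ ⟨
  ξ-step (Ξ (l (l y))) (Ξ (l (r y))) (Ξ (r (r y)))              ∎
  where
  open ≡-Reasoning
  window₀ : Ξ (l (l y)) ≡ altSign b
  window₀ = trans (cong (Ξ ∘ l) (l-iterate not b (3 + double k)))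
                  (trans (cong Ξ (l-iterate not b (2 + double k))) (Ξ-alternating k b))
  window₁ : Ξ (l (r y)) ≡ altSign (not b)
  window₁ = trans (cong Ξ (l-iterate not (not b) (2 + double k))) (Ξ-alternating k (not b))
  window₂ : Ξ (r (r y)) ≡ altSign b
  window₂ = trans (Ξ-alternating k (not (not b))) (cong altSign (not-involutive b))
... | inj₂ (not-alternating , Ξy) = begin
  Ξ y                                                          ≡⟨ Ξy ⟩
  Ξ (l y) ⊕ Ξ (r y)                                            ≡⟨ cong₂ _⊕_ Ξly Ξry ⟩
  (Ξ (l (l y)) ⊕ Ξ (l (r y))) ⊕ (Ξ (l (r y)) ⊕ Ξ (r (r y)))    ≡⟨ ξ-step-¬zigzag _ _ _ not-zigzag ⟨
  ξ-step (Ξ (l (l y))) (Ξ (l (r y))) (Ξ (r (r y)))             ∎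
  where
  open ≡-Reasoning
  Ξly : Ξ (l y) ≡ Ξ (l (l y)) ⊕ Ξ (l (r y))
  Ξly = trans (Ξ-odd (suc k) (l y) (length-l y eq)) (cong (λ w → Ξ (l (l y)) ⊕ Ξ w) (r-l y))
  Ξry : Ξ (r y) ≡ Ξ (l (r y)) ⊕ Ξ (r (r y))
  Ξry = Ξ-odd (suc k) (r y) (length-r y eq)
  not-zigzag : ∀ b → ¬ Zigzag b (Ξ (l (l y))) (Ξ (l (r y))) (Ξ (r (r y)))
  not-zigzag b zigzag = not-alternating b (forces y eq b zigzag)

Φ-two-step-window : ∀ {k} → PhiFlatForcesConstant k → ∀ i j x → length x ≡ i + (j + (3 + double k)) →
  Φ (window i j x) ≡ φ-step (Φ (window i (2 + j) x)) (Φ (window (1 + i) (1 + j) x)) (Φ (window (2 + i) j x))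
Φ-two-step-window {k} forces i j x eq =
  trans (Φ-two-step forces (window i j x) (length-window i j x (3 + double k) eq))
        (cong₂ (λ u v → φ-step (Φ (window i (2 + j) x)) (Φ u) (Φ v)) (lr-window i j x) (rr-window i j x))

flat-forces-window : ∀ {k} → PhiFlatForcesConstant k → ∀ i j x → length x ≡ i + (j + (3 + double k)) → ∀ b →
  Flat b (Φ (window i (2 + j) x)) (Φ (window (1 + i) (1 + j) x)) (Φ (window (2 + i) j x)) →
  window i j x ≡ iterate id b (3 + double k)
flat-forces-window {k} forces i j x eq b (f₀ , f₁ , f₂) =
  forces (window i j x) (length-window i j x (3 + double k) eq) b
         (f₀ , trans (cong Φ (lr-window i j x)) f₁ , trans (cong Φ (rr-window i j x)) f₂)

zigzag-forces-window : ∀ {k} → XiZigzagForcesAlternating k → ∀ i j x → length x ≡ i + (j + (4 + double k)) → ∀ b →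
  Zigzag b (Ξ (window i (2 + j) x)) (Ξ (window (1 + i) (1 + j) x)) (Ξ (window (2 + i) j x)) →
  window i j x ≡ iterate not b (4 + double k)
zigzag-forces-window {k} forces i j x eq b (z₀ , z₁ , z₂) =
  forces (window i j x) (length-window i j x (4 + double k) eq) b
         (z₀ , trans (cong Ξ (lr-window i j x)) z₁ , trans (cong Ξ (rr-window i j x)) z₂)

-- Tokens

Cell : Set
Cell = Sgn × Bool

-- A cell of y is ξ y paired with the token of l (r y); token turns it into the token of y,
-- which is minus the sign of ξ y unless ξ y = ⁰ (a token o stands for the sign bitSign o).
token : Cell → Bool
token (⁰ , o) = o
token (⁺ , _) = false
token (⁻ , _) = true

Coherent : Cell → Cell → Set
Coherent c (⁰ , o′) = o′ ≡ token c
Coherent (⁰ , o) (e′ , _) = e′ ≡ bitSign o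
Coherent _ _ = ⊤

coherent? : ∀ c c′ → Dec (Coherent c c′)
coherent? c (⁰ , o′) = o′ ≟ᵇ token c
coherent? (⁰ , o) (⁻ , _) = ⁻ ≟ bitSign o
coherent? (⁰ , o) (⁺ , _) = ⁺ ≟ bitSign o
coherent? (⁻ , _) (⁻ , _) = yes _
coherent? (⁻ , _) (⁺ , _) = yes _
coherent? (⁺ , _) (⁻ , _) = yes _
coherent? (⁺ , _) (⁺ , _) = yes _

∀ᶜ? : {P : Cell → Set} → ((c : Cell) → Dec (P c)) → Dec ((c : Cell) → P c)
∀ᶜ? P? = map′ (λ f (e , o) → f e o) (λ f e o → f (e , o)) (∀ˢ? λ e → ∀ᵇ? λ o → P? (e , o))

cellStep : Cell → Cell → Cell → Cell
cellStep (e₀ , _) c₁ (e₂ , _) = ξ-step e₀ (proj₁ c₁) e₂ , token c₁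

-- For two letters a b the centre is empty; taking not a as its token makes the base case coherent.
centralToken-fuel : ℕ → List Bool → Bool
centralToken-fuel _ (a ∷ _ ∷ []) = not a
centralToken-fuel (suc (suc n)) (_ ∷ b ∷ c ∷ t) = token (Ξ m , centralToken-fuel n m)
  where m = l (b ∷ c ∷ t)
centralToken-fuel _ _ = false

centralToken : List Bool → Bool
centralToken y = centralToken-fuel (length y) y

cell : List Bool → Cell
cell y = Ξ y , centralToken y

centralToken-unfold : ∀ y n → length y ≡ 3 + n → centralToken y ≡ token (cell (l (r y)))
centralToken-unfold (a ∷ b ∷ c ∷ t) n _ rewrite length-l-∷ b (c ∷ t) = refl

cell-two-step-window : ∀ {k} → XiZigzagForcesAlternating k → ∀ i j x → length x ≡ i + (j + (4 + double k)) →
  cell (window i j x) ≡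
  cellStep (cell (window i (2 + j) x)) (cell (window (1 + i) (1 + j) x)) (cell (window (2 + i) j x))
cell-two-step-window {k} forces i j x eq =
  trans (cong₂ _,_ (Ξ-two-step forces (window i j x) eq′) (centralToken-unfold (window i j x) (1 + double k) eq′))
        (cong₂ (λ u v → cellStep (cell (window i (2 + j) x)) (cell u) (cell v)) (lr-window i j x) (rr-window i j x))
  where eq′ = length-window i j x (4 + double k) eq

XiCoherent : ℕ → Set
XiCoherent k = ∀ x → length x ≡ 3 + double k → Coherent (cell (l x)) (cell (r x))

coherent-window : ∀ {k} → XiCoherent k → ∀ i j x → length x ≡ i + (j + (3 + double k)) →
  Coherent (cell (window i (suc j) x)) (cell (window (suc i) j x))
coherent-window {k} coherent i j x eq =
  subst (λ w → Coherent (cell (window i (suc j) x)) (cell w)) (r-window i j x)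
        (coherent (window i j x) (length-window i j x (3 + double k) eq))

-- Local facts about signs

cellStep-coherent : ∀ c₀ c₁ c₂ c₃ → Coherent c₀ c₁ → Coherent c₁ c₂ → Coherent c₂ c₃ →
  Coherent (cellStep c₀ c₁ c₂) (cellStep c₁ c₂ c₃)
cellStep-coherent = from-yes (∀ᶜ? λ c₀ → ∀ᶜ? λ c₁ → ∀ᶜ? λ c₂ → ∀ᶜ? λ c₃ →
  coherent? c₀ c₁ →-dec coherent? c₁ c₂ →-dec coherent? c₂ c₃ →-dec
  coherent? (cellStep c₀ c₁ c₂) (cellStep c₁ c₂ c₃))

zigzag-descends : ∀ b c₀ c₁ c₂ c₃ c₄ →
  Coherent c₀ c₁ → Coherent c₁ c₂ → Coherent c₂ c₃ → Coherent c₃ c₄ →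
  let e₀ = proj₁ c₀ ; e₁ = proj₁ c₁ ; e₂ = proj₁ c₂ ; e₃ = proj₁ c₃ ; e₄ = proj₁ c₄ in
  Zigzag b (ξ-step e₀ e₁ e₂) (ξ-step e₁ e₂ e₃) (ξ-step e₂ e₃ e₄) →
  Zigzag b e₀ e₁ e₂ × Zigzag (not b) e₁ e₂ e₃ × Zigzag b e₂ e₃ e₄
zigzag-descends = from-yes (∀ᵇ? λ b → ∀ᶜ? λ c₀ → ∀ᶜ? λ c₁ → ∀ᶜ? λ c₂ → ∀ᶜ? λ c₃ → ∀ᶜ? λ c₄ →
  let e₀ = proj₁ c₀ ; e₁ = proj₁ c₁ ; e₂ = proj₁ c₂ ; e₃ = proj₁ c₃ ; e₄ = proj₁ c₄ in
  coherent? c₀ c₁ →-dec coherent? c₁ c₂ →-dec coherent? c₂ c₃ →-dec coherent? c₃ c₄ →-dec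
  zigzag? b (ξ-step e₀ e₁ e₂) (ξ-step e₁ e₂ e₃) (ξ-step e₂ e₃ e₄) →-dec
  (zigzag? b e₀ e₁ e₂ ×-dec zigzag? (not b) e₁ e₂ e₃ ×-dec zigzag? b e₂ e₃ e₄))

φ-step-nonzero : ∀ s₀ s₁ s₂ → s₀ ≢ ⁰ → s₁ ≢ ⁰ → s₂ ≢ ⁰ → φ-step s₀ s₁ s₂ ≢ ⁰
φ-step-nonzero = from-yes (∀ˢ? λ s₀ → ∀ˢ? λ s₁ → ∀ˢ? λ s₂ →
  ¬? (s₀ ≟ ⁰) →-dec ¬? (s₁ ≟ ⁰) →-dec ¬? (s₂ ≟ ⁰) →-dec ¬? (φ-step s₀ s₁ s₂ ≟ ⁰))

flat-descends : ∀ b s₀ s₁ s₂ s₃ s₄ → s₀ ≢ ⁰ → s₁ ≢ ⁰ → s₂ ≢ ⁰ → s₃ ≢ ⁰ → s₄ ≢ ⁰ →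
  Flat b (φ-step s₀ s₁ s₂) (φ-step s₁ s₂ s₃) (φ-step s₂ s₃ s₄) →
  Flat b s₀ s₁ s₂ × Flat b s₁ s₂ s₃ × Flat b s₂ s₃ s₄
flat-descends = from-yes (∀ᵇ? λ b → ∀ˢ? λ s₀ → ∀ˢ? λ s₁ → ∀ˢ? λ s₂ → ∀ˢ? λ s₃ → ∀ˢ? λ s₄ →
  ¬? (s₀ ≟ ⁰) →-dec ¬? (s₁ ≟ ⁰) →-dec ¬? (s₂ ≟ ⁰) →-dec ¬? (s₃ ≟ ⁰) →-dec ¬? (s₄ ≟ ⁰) →-dec
  flat? b (φ-step s₀ s₁ s₂) (φ-step s₁ s₂ s₃) (φ-step s₂ s₃ s₄) →-dec
  (flat? b s₀ s₁ s₂ ×-dec flat? b s₁ s₂ s₃ ×-dec flat? b s₂ s₃ s₄))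

ξ-step-zero⇔φ-step-equal : ∀ c₀ c₁ c₂ s₀ s₁ s₂ s₃ → s₀ ≢ ⁰ → s₁ ≢ ⁰ → s₂ ≢ ⁰ → s₃ ≢ ⁰ →
  Coherent c₀ c₁ → Coherent c₁ c₂ →
  let e₀ = proj₁ c₀ ; e₁ = proj₁ c₁ ; e₂ = proj₁ c₂ in
  (e₀ ≡ ⁰ ⇔ s₀ ≡ s₁) → (e₁ ≡ ⁰ ⇔ s₁ ≡ s₂) → (e₂ ≡ ⁰ ⇔ s₂ ≡ s₃) →
  (ξ-step e₀ e₁ e₂ ≡ ⁰ ⇔ φ-step s₀ s₁ s₂ ≡ φ-step s₁ s₂ s₃)
ξ-step-zero⇔φ-step-equal = from-yes (∀ᶜ? λ c₀ → ∀ᶜ? λ c₁ → ∀ᶜ? λ c₂ → ∀ˢ? λ s₀ → ∀ˢ? λ s₁ → ∀ˢ? λ s₂ → ∀ˢ? λ s₃ →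
  let e₀ = proj₁ c₀ ; e₁ = proj₁ c₁ ; e₂ = proj₁ c₂ in
  ¬? (s₀ ≟ ⁰) →-dec ¬? (s₁ ≟ ⁰) →-dec ¬? (s₂ ≟ ⁰) →-dec ¬? (s₃ ≟ ⁰) →-dec
  coherent? c₀ c₁ →-dec coherent? c₁ c₂ →-dec
  (e₀ ≟ ⁰ ⇔? s₀ ≟ s₁) →-dec (e₁ ≟ ⁰ ⇔? s₁ ≟ s₂) →-dec (e₂ ≟ ⁰ ⇔? s₂ ≟ s₃) →-dec
  (ξ-step e₀ e₁ e₂ ≟ ⁰ ⇔? φ-step s₀ s₁ s₂ ≟ φ-step s₁ s₂ s₃))

-- The induction

PhiNonzero : ℕ → Set
PhiNonzero k = ∀ x → length x ≡ 1 + double k → Φ x ≢ ⁰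

XiZeroIffPhiEqual : ℕ → Set
XiZeroIffPhiEqual k = ∀ x → length x ≡ 2 + double k → (Ξ x ≡ ⁰ ⇔ Φ (l x) ≡ Φ (r x))

φ-invariants : ∀ k → PhiNonzero k × PhiFlatForcesConstant k
φ-invariants zero = nonzero₀ , flat₀
  where
  nonzero₀ : PhiNonzero 0
  nonzero₀ (false ∷ []) _ ()
  nonzero₀ (true ∷ []) _ ()
  flat₀ : PhiFlatForcesConstant 0
  flat₀ (a ∷ b ∷ c ∷ []) refl = from-yes (∀ᵇ? λ a → ∀ᵇ? λ b → ∀ᵇ? λ c → ∀ᵇ? λ β →
    flat? β (Φ [ a ]) (Φ [ b ]) (Φ [ c ]) →-dec ≡-decᴸ _≟ᵇ_ (a ∷ b ∷ c ∷ []) (iterate id β 3)) a b c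
φ-invariants (suc k) = nonzero , flat
  where
  IH = φ-invariants k
  nonzero-window : ∀ i j x → length x ≡ i + (j + (1 + double k)) → Φ (window i j x) ≢ ⁰
  nonzero-window i j x eq = proj₁ IH (window i j x) (length-window i j x (1 + double k) eq)
  nonzero : PhiNonzero (suc k)
  nonzero x eq rewrite Φ-two-step (proj₂ IH) x eq =
    φ-step-nonzero _ _ _ (nonzero-window 0 2 x eq) (nonzero-window 1 1 x eq) (nonzero-window 2 0 x eq)
  flat : PhiFlatForcesConstant (suc k)
  flat x eq b (f₀ , f₁ , f₂) = window-iterate id b _ 0 0 x x₀₁ x₁₀
    where
    forces = proj₂ IH
    s₀ = Φ (window 0 4 x) ; s₁ = Φ (window 1 3 x) ; s₂ = Φ (window 2 2 x)
    s₃ = Φ (window 3 1 x) ; s₄ = Φ (window 4 0 x)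
    below : Flat b s₀ s₁ s₂ × Flat b s₁ s₂ s₃ × Flat b s₂ s₃ s₄
    below = flat-descends b s₀ s₁ s₂ s₃ s₄
      (nonzero-window 0 4 x eq) (nonzero-window 1 3 x eq) (nonzero-window 2 2 x eq)
      (nonzero-window 3 1 x eq) (nonzero-window 4 0 x eq)
      ( trans (sym (Φ-two-step-window forces 0 2 x eq)) f₀
      , trans (sym (Φ-two-step-window forces 1 1 x eq)) f₁
      , trans (sym (Φ-two-step-window forces 2 0 x eq)) f₂ )
    x₀₂ : window 0 2 x ≡ iterate id b (3 + double k)
    x₀₂ = flat-forces-window forces 0 2 x eq b (proj₁ below)
    x₁₁ : window 1 1 x ≡ iterate id b (3 + double k)
    x₁₁ = flat-forces-window forces 1 1 x eq b (proj₁ (proj₂ below))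
    x₂₀ : window 2 0 x ≡ iterate id b (3 + double k)
    x₂₀ = flat-forces-window forces 2 0 x eq b (proj₂ (proj₂ below))
    x₀₁ : window 0 1 x ≡ iterate id b (4 + double k)
    x₀₁ = window-iterate id b _ 0 1 x x₀₂ x₁₁
    x₁₀ : window 1 0 x ≡ iterate id b (4 + double k)
    x₁₀ = window-iterate id b _ 1 0 x x₁₁ x₂₀

ξ-invariants : ∀ k → XiCoherent k × XiZigzagForcesAlternating k
ξ-invariants zero = coherent₀ , zigzag₀
  where
  coherent₀ : XiCoherent 0
  coherent₀ (a ∷ b ∷ c ∷ []) refl = from-yes (∀ᵇ? λ a → ∀ᵇ? λ b → ∀ᵇ? λ c →
    coherent? (cell (a ∷ b ∷ [])) (cell (b ∷ c ∷ []))) a b c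
  zigzag₀ : XiZigzagForcesAlternating 0
  zigzag₀ (a ∷ b ∷ c ∷ d ∷ []) refl = from-yes (∀ᵇ? λ a → ∀ᵇ? λ b → ∀ᵇ? λ c → ∀ᵇ? λ d → ∀ᵇ? λ β →
    zigzag? β (Ξ (a ∷ b ∷ [])) (Ξ (b ∷ c ∷ [])) (Ξ (c ∷ d ∷ [])) →-dec
    ≡-decᴸ _≟ᵇ_ (a ∷ b ∷ c ∷ d ∷ []) (iterate not β 4)) a b c d
ξ-invariants (suc k) = coherent , zigzag
  where
  IH = ξ-invariants k
  coherent : XiCoherent (suc k)
  coherent x eq =
    subst₂ Coherent (sym (cell-two-step-window forces 0 1 x eq)) (sym (cell-two-step-window forces 1 0 x eq))
      (cellStep-coherent _ _ _ _ (coherent-window (proj₁ IH) 0 2 x eq) (coherent-window (proj₁ IH) 1 1 x eq)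
                                 (coherent-window (proj₁ IH) 2 0 x eq))
    where forces = proj₂ IH
  zigzag : XiZigzagForcesAlternating (suc k)
  zigzag y eq b (z₀ , z₁ , z₂) = window-iterate not b _ 0 0 y y₀₁ y₁₀
    where
    forces = proj₂ IH
    coherent-at : ∀ i j → length y ≡ i + (j + (3 + double k)) →
      Coherent (cell (window i (suc j) y)) (cell (window (suc i) j y))
    coherent-at i j = coherent-window (proj₁ IH) i j y
    e₀ = Ξ (window 0 4 y) ; e₁ = Ξ (window 1 3 y) ; e₂ = Ξ (window 2 2 y)
    e₃ = Ξ (window 3 1 y) ; e₄ = Ξ (window 4 0 y)
    below : Zigzag b e₀ e₁ e₂ × Zigzag (not b) e₁ e₂ e₃ × Zigzag b e₂ e₃ e₄
    below = zigzag-descends b (cell (window 0 4 y)) (cell (window 1 3 y)) (cell (window 2 2 y))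
      (cell (window 3 1 y)) (cell (window 4 0 y))
      (coherent-at 0 3 eq) (coherent-at 1 2 eq) (coherent-at 2 1 eq) (coherent-at 3 0 eq)
      ( trans (sym (cong proj₁ (cell-two-step-window forces 0 2 y eq))) z₀
      , trans (sym (cong proj₁ (cell-two-step-window forces 1 1 y eq))) z₁
      , trans (sym (cong proj₁ (cell-two-step-window forces 2 0 y eq))) z₂ )
    y₀₂ : window 0 2 y ≡ iterate not b (4 + double k)
    y₀₂ = zigzag-forces-window forces 0 2 y eq b (proj₁ below)
    y₁₁ : window 1 1 y ≡ iterate not (not b) (4 + double k)
    y₁₁ = zigzag-forces-window forces 1 1 y eq (not b) (proj₁ (proj₂ below))
    y₂₀ : window 2 0 y ≡ iterate not (not (not b)) (4 + double k)
    y₂₀ = trans (zigzag-forces-window forces 2 0 y eq b (proj₂ (proj₂ below)))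
                (cong (λ c → iterate not c (4 + double k)) (sym (not-involutive b)))
    y₀₁ : window 0 1 y ≡ iterate not b (5 + double k)
    y₀₁ = window-iterate not b _ 0 1 y y₀₂ y₁₁
    y₁₀ : window 1 0 y ≡ iterate not (not b) (5 + double k)
    y₁₀ = window-iterate not (not b) _ 1 0 y y₁₁ y₂₀

⇔-resp : ∀ {a a′ b b′ c c′ : Sgn} → a ≡ a′ → b ≡ b′ → c ≡ c′ → (a′ ≡ ⁰ ⇔ b′ ≡ c′) → (a ≡ ⁰ ⇔ b ≡ c)
⇔-resp refl refl refl h = h

Ξ≡⁰⇔Φl≡Φr : ∀ k → XiZeroIffPhiEqual k
Ξ≡⁰⇔Φl≡Φr zero (a ∷ b ∷ []) refl = from-yes (∀ᵇ? λ a → ∀ᵇ? λ b →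
  Ξ (a ∷ b ∷ []) ≟ ⁰ ⇔? Φ [ a ] ≟ Φ [ b ]) a b
Ξ≡⁰⇔Φl≡Φr (suc k) x eq =
  ⇔-resp (Ξ-two-step forces x eq) (Φ-two-step-window flat 0 1 x eq) (Φ-two-step-window flat 1 0 x eq)
    (ξ-step-zero⇔φ-step-equal _ _ _ _ _ _ _
               (nonzero-at 0 3 eq) (nonzero-at 1 2 eq) (nonzero-at 2 1 eq) (nonzero-at 3 0 eq)
               (coherent-window coherent 0 1 x eq) (coherent-window coherent 1 0 x eq)
               (link-at 0 2 eq) (link-at 1 1 eq) (link-at 2 0 eq))
  where
  nonzero = proj₁ (φ-invariants k)
  flat = proj₂ (φ-invariants k)
  coherent = proj₁ (ξ-invariants k)
  forces = proj₂ (ξ-invariants k)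
  nonzero-at : ∀ i j → length x ≡ i + (j + (1 + double k)) → Φ (window i j x) ≢ ⁰
  nonzero-at i j e = nonzero (window i j x) (length-window i j x _ e)
  link-at : ∀ i j → length x ≡ i + (j + (2 + double k)) →
    (Ξ (window i j x) ≡ ⁰ ⇔ Φ (window i (suc j) x) ≡ Φ (window (suc i) j x))
  link-at i j e = ⇔-resp refl refl (cong Φ (sym (r-window i j x)))
                         (Ξ≡⁰⇔Φl≡Φr k (window i j x) (length-window i j x _ e))

data Parity : ℕ → Set where
  empty : Parity 0
  odd   : ∀ k → Parity (1 + double k)
  even  : ∀ k → Parity (2 + double k)

parity : ∀ n → Parity n
parity zero = empty
parity (suc n) with parity n
... | empty  = odd 0
... | odd k  = even k
... | even k = odd (suc k)

Φ≡⁰⇒Ξ≡⁰ : ∀ w → Φ w ≡ ⁰ → Ξ w ≡ ⁰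
Φ≡⁰⇒Ξ≡⁰ w = by-parity w (parity (length w)) refl
  where
  by-parity : ∀ {n} w → Parity n → length w ≡ n → Φ w ≡ ⁰ → Ξ w ≡ ⁰
  by-parity [] empty _ _ = refl
  by-parity w (odd k) eq Φw = contradiction Φw (proj₁ (φ-invariants k) w eq)
  by-parity w (even k) eq Φw =
    Equivalence.from (Ξ≡⁰⇔Φl≡Φr k w eq) (sym (⊖≡⁰⇒≡ _ _ (trans (sym (Φ-even k w eq)) Φw)))

lemma5p3 : (w : List Bool) → (ψ w ≡ + 0 → ξ w ≡ + 0) × (ξ w ≡ + 0 → ψ w ≡ + 0)
lemma5p3 w = ψ≡0⇒ξ≡0 , ξ≡0⇒ψ≡0 w
  where
  ξ≡⟦Ξ⟧ : ξ w ≡ ⟦ Ξ w ⟧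
  ξ≡⟦Ξ⟧ = sym (⟦Ξ-fuel⟧ (length w) w)
  ψ≡0⇒ξ≡0 : ψ w ≡ + 0 → ξ w ≡ + 0
  ψ≡0⇒ξ≡0 ψw with i*j≡0⇒i≡0∨j≡0 (ξ w ^ length w) ψw
  ... | inj₁ ξⁿ≡0 = i^n≡0⇒i≡0 (ξ w) (length w) ξⁿ≡0
  ... | inj₂ φ≡0 =
    trans ξ≡⟦Ξ⟧ (cong ⟦_⟧ (Φ≡⁰⇒Ξ≡⁰ w (⟦⟧≡0⇒≡⁰ (Φ w) (trans (⟦Φ-fuel⟧ (length w) w) φ≡0))))
  ξ≡0⇒ψ≡0 : ∀ v → ξ v ≡ + 0 → ψ v ≡ + 0
  ξ≡0⇒ψ≡0 [] _ = refl
  ξ≡0⇒ψ≡0 v@(_ ∷ _) ξv = cong (λ z → z ^ length v * φ v) ξv
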